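{- Let $n\ge 2$, $K\ge 2$, and let $\mathcal{P}=\{P_1,\dots,P_K\}$ be signed permutations over $[n]=\{1,\dots,n\}$ with $P_1=\mathit{Id}_n=(1\,2\,\dots\,n)$. Let $b,B:[n]\to[n]$ be any functions with $b_t:=b(t)\le m_t$ and $B_t:=B(t)\ge M_t$ for all $t\in[n-1]$. Run the procedure LR-Search (described in the context) and let $\mathit{Pairs}_t$ be the set it produces at step $t$. Then $$\bigcup_{1\le t<n}\mathit{Pairs}_t$$ is exactly the set of all sets $(t..x)=\{t,t+1,\dots,x\}$ with $1\le t<x\le n$ that are common intervals of $\mathcal{P}$ (ignoring signs) and satisfy $$t=b_t=\min\{b_w : t\le w\le x-1\}\quad\text{and}\quad x=B_{x-1}=\max\{B_w : t\le w\le x-1\}.$$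
   Context: A signed permutation over $[n]$ is a permutation of $[n]$ together with a sign $+$ or $-$ attached to each element; signs are ignored throughout this statement. For $1\le i<j\le n$, the interval $[i,j]$ of a permutation $P$ is the set of elements located at positions $i$ through $j$ (inclusive) in $P$; intervals thus always have at least 2 elements. A common interval of $\mathcal{P}$ is a set of integers that is an interval of every $P_k$, $k\in[K]$. For $t\in[n-1]$ and $2\le k\le K$, let $m_t^k$ (resp. $M_t^k$) be the minimum (resp. maximum) value in the interval of $P_k$ delimited by the elements $t$ and $t+1$ (both included), and let $m_t=\min_{2\le k\le K}m_t^k$, $M_t=\max_{2\le k\le K}M_t^k$. Procedure LR-Search. It maintains a finite sequence of pairs $(a_1,S_1),(a_2,S_2),\dots,(a_p,S_p)$ ($p\ge 0$), where $a_1>a_2>\dots>a_p$ are integers and $S_1,\dots,S_p$ are nonempty pairwise disjoint sets of integers. Initially $p=0$. For $t=n-1,n-2,\dots,1$ (in this order) it performs: (i) If $p\ge1$ and $a_1>b_t$: let $j$ be the largest index with $a_j>b_t$. If $j<p$ and $a_{j+1}=b_t$, replace the pairs $(a_1,S_1),\dots,(a_{j+1},S_{j+1})$ by the single pair $(b_t,S_1\cup\dots\cup S_{j+1})$; otherwise replace $(a_1,S_1),\dots,(a_j,S_j)$ by the single pair $(b_t,S_1\cup\dots\cup S_j)$, placed first. (ii) Remove from every $S_i$ all elements smaller than $B_t$, and then delete every pair whose set has become empty. (iii) If $B_t=t+1$: if $p\ge1$ and $a_1=b_t$, add $t+1$ to $S_1$; otherwise insert the pair $(b_t,\{t+1\})$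 at the front of the sequence. (iv) If some pair of the current sequence has first component $a_i=t$, set $\mathit{Set}^t(t):=S_i$; otherwise $\mathit{Set}^t(t):=\emptyset$. Define $\mathit{Pairs}_t:=\{(t..x): x\in \mathit{Set}^t(t)\}$. -}

module Defs where

open import Data.Nat using (ℕ; zero; suc; _+_; _∸_; _≤_; _<_; _⊓_; _⊔_; _≟_; _<?_; _≤ᵇ_; _≡ᵇ_)
open import Data.Fin as Fin using (Fin; toℕ)
open import Data.Fin.Permutation using (Permutation; _⟨$⟩ʳ_)
open import Data.Bool using (Bool; true; false; if_then_else_)
open import Data.List as List using (List; []; _∷_; _++_; map; filter; concat; span; upTo; foldr)
open import Data.List.Membership.Propositional using (_∈_)
open import Data.Product using (Σ; _×_; _,_; proj₁; proj₂; ∃; ∃-syntax)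
open import Data.Sum using (_⊎_)
open import Relation.Binary.PropositionalEquality using (_≡_)
open import Relation.Nullary using (¬_)
open import Function.Bundles using (_⇔_)

-- Positions are Fin n (position i is the (toℕ i + 1)-th position);
-- the element at a position is a value v : Fin n, read as the integer
-- toℕ v + 1 ∈ [n].  The signs are carried but never used.

record SignedPerm (n : ℕ) : Set where
  field
    perm : Permutation n n      -- position ↦ element (as Fin code)
    sign : Fin n → Bool
open SignedPerm public

elemAt : ∀ {n} → SignedPerm n → Fin n → ℕ
elemAt P i = suc (toℕ (perm P ⟨$⟩ʳ i))

IsId : ∀ {n} → SignedPerm n → Set
IsId {n} P = ∀ (i : Fin n) → perm P ⟨$⟩ʳ i ≡ i

SetEq : (ℕ → Set) → (ℕ → Set) → Set
SetEq I J = ∀ e → I e ⇔ J e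

Range : ℕ → ℕ → ℕ → Set
Range t x e = t ≤ e × e ≤ x

IsIntervalOf : ∀ {n} → SignedPerm n → (ℕ → Set) → Set
IsIntervalOf {n} P I =
  Σ (Fin n) λ i → Σ (Fin n) λ j → (i Fin.< j) ×
    SetEq I (λ e → ∃[ p ] (i Fin.≤ p × p Fin.≤ j × elemAt P p ≡ e))

IsCommonInterval : ∀ {n K} → (Fin K → SignedPerm n) → (ℕ → Set) → Set
IsCommonInterval Ps I = ∀ k → IsIntervalOf (Ps k) I

InDelim : ∀ {n} → SignedPerm n → ℕ → ℕ → Set
InDelim P t e =
  ∃[ i ] ∃[ j ] ∃[ p ] (elemAt P i ≡ t × elemAt P j ≡ suc t ×
     ((i Fin.≤ p × p Fin.≤ j) ⊎ (j Fin.≤ p × p Fin.≤ i)) × elemAt P p ≡ e)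

-- "b_t ≤ m_t" where m_t = min over k ∈ {2..K} of m_t^k, i.e. b_t is at most
-- every element of every interval of P_k (k ≥ 2) delimited by t and t+1.
-- (Fin index k corresponds to P_{toℕ k + 1}.)
BelowMin : ∀ {n K} → (Fin K → SignedPerm n) → ℕ → ℕ → Set
BelowMin Ps t v = ∀ k → ¬ (toℕ k ≡ 0) → ∀ e → InDelim (Ps k) t e → v ≤ e

AboveMax : ∀ {n K} → (Fin K → SignedPerm n) → ℕ → ℕ → Set
AboveMax Ps t v = ∀ k → ¬ (toℕ k ≡ 0) → ∀ e → InDelim (Ps k) t e → e ≤ v

rangeList : ℕ → ℕ → List ℕ
rangeList t y = map (t +_) (upTo (suc y ∸ t))

minOver : (ℕ → ℕ) → ℕ → ℕ → ℕ
minOver f t y = foldr _⊓_ (f t) (map f (rangeList t y))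

maxOver : (ℕ → ℕ) → ℕ → ℕ → ℕ
maxOver f t y = foldr _⊔_ (f t) (map f (rangeList t y))

-- Procedure LR-Search.  The sequence (a_1,S_1),…,(a_p,S_p) is a list of
-- pairs, sets S_i being lists of integers.

State : Set
State = List (ℕ × List ℕ)

module LR (n : ℕ) (b B : ℕ → ℕ) where

  stepI : ℕ → State → State
  stepI t s with span (λ (q : ℕ × List ℕ) → b t <? proj₁ q) s
  ... | [] , rest = rest
  ... | pre@(_ ∷ _) , [] = (b t , concat (map proj₂ pre)) ∷ []
  ... | pre@(_ ∷ _) , (a' , S') ∷ rest =
        if a' ≡ᵇ b t
          then (b t , concat (map proj₂ pre) ++ S') ∷ rest
          else (b t , concat (map proj₂ pre)) ∷ (a' , S') ∷ rest

  nonEmpty : List ℕ → Bool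
  nonEmpty [] = false
  nonEmpty (_ ∷ _) = true

  stepII : ℕ → State → State
  stepII t s =
    List.filterᵇ (λ q → nonEmpty (proj₂ q))
      (map (λ q → proj₁ q , List.filterᵇ (λ x → B t ≤ᵇ x) (proj₂ q)) s)

  stepIII : ℕ → State → State
  stepIII t s with B t ≡ᵇ suc t | s
  ... | false | s' = s'
  ... | true  | [] = (b t , suc t ∷ []) ∷ []
  ... | true  | (a₁ , S₁) ∷ rest =
        if a₁ ≡ᵇ b t
          then (a₁ , S₁ ++ (suc t ∷ [])) ∷ rest
          else (b t , suc t ∷ []) ∷ (a₁ , S₁) ∷ rest

  step : ℕ → State → State
  step t s = stepIII t (stepII t (stepI t s))

  -- state after k steps, i.e. after processing t = n-1, n-2, …, n-k
  run : ℕ → State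
  run zero = []
  run (suc k) = step (n ∸ suc k) (run k)

  lookupSet : ℕ → State → List ℕ
  lookupSet t [] = []
  lookupSet t ((a , S) ∷ rest) = if a ≡ᵇ t then S else lookupSet t rest

  -- Set^t(t), computed from the state right after step t
  SetT : ℕ → List ℕ
  SetT t = lookupSet t (run (n ∸ t))

  InUnionPairs : (ℕ → Set) → Set
  InUnionPairs I =
    ∃[ t ] ∃[ x ] (1 ≤ t × t < n × x ∈ SetT t × SetEq I (Range t x))

module Submission where

open import Defs
open import Data.Nat
  using (ℕ; zero; suc; _+_; _∸_; _≤_; _<_; _⊓_; _⊔_; _≡ᵇ_; _≤ᵇ_; _<ᵇ_; _<?_; _≟_; z≤n; s≤s; s≤s⁻¹; NonZero)
open import Data.Nat.Properties
open import Data.Nat.DivMod using (_mod_; m<n⇒m%n≡m)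
open import Data.Bool using (true; false; T)
open import Data.Bool.Properties using (T?)
open import Data.Fin as Fin using (Fin; toℕ)
open import Data.Fin.Properties using (toℕ-injective; toℕ-fromℕ<)
open import Data.Fin.Permutation using (_⟨$⟩ˡ_; inverseʳ)
open import Data.List as List using (List; []; _∷_; _++_; map; concat; span)
open import Data.List.Properties using (foldr-preservesᵇ; foldr-preservesᵒ)
open import Data.List.Membership.Propositional using (_∈_)
open import Data.List.Membership.Propositional.Properties
  using (∈-map⁺; ∈-map⁻; ∈-upTo⁺; ∈-upTo⁻; ∈-++⁺ˡ; ∈-++⁺ʳ; ∈-++⁻; ∈-concat⁺′; ∈-concat⁻′
        ; ∈-filter⁺; ∈-filter⁻; foldr-selective)
open import Data.List.Relation.Unary.Any as Any using (here; there)
open import Data.List.Relation.Unary.All as All using (All; []; _∷_)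
open import Data.List.Relation.Unary.All.Properties as All using ()
open import Data.List.Relation.Unary.AllPairs as AllPairs using (AllPairs; []; _∷_)
open import Data.List.Relation.Unary.AllPairs.Properties as AllPairs using ()
open import Data.Product using (_×_; _,_; proj₁; proj₂; ∃-syntax)
open import Data.Sum using (_⊎_; inj₁; inj₂; [_,_]′)
open import Data.Unit using (tt)
open import Function using (_∘_)
open import Function.Bundles using (_⇔_; mk⇔; Equivalence)
open import Function.Construct.Composition as Compose using ()
open import Relation.Nullary using (¬_; yes; no; contradiction)
open import Relation.Binary.PropositionalEquality

-- After step t, LR-Search stores exactly the right ends x > t with B_{x-1} = x = max{B_w : t ≤ w < x},
-- each under the key min{b_w : t ≤ w < x}, the keys being strictly decreasing; so Set^t(t) holds
-- exactly those x whose minimum is t.  Step (i) turns every key a into min(a, b_t), step (ii) drops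
-- the x below B_t, and step (iii) adds x = t+1 when B_t = t+1.
-- Such a (t..x) is a common interval: trivially in P_1 = Id, and in P_k the stretch between w and
-- w+1 (t ≤ w < x) lies within [b_w, B_w] ⊆ [t, x], so the positions of t..x form a contiguous
-- window.  Finally t lies in its own delimited interval in P_2, so b_t ≤ m_t ≤ t, and a minimum of
-- b equal to t forces b_t = t.

Between : ℕ → ℕ → ℕ → Set
Between a p c = (a ≤ p × p ≤ c) ⊎ (c ≤ p × p ≤ a)

between-split : ∀ {a p c} m → Between a p c → Between a p m ⊎ Between m p c
between-split {p = p} m (inj₁ (a≤p , p≤c)) with ≤-total p m
... | inj₁ p≤m = inj₁ (inj₁ (a≤p , p≤m))
... | inj₂ m≤p = inj₂ (inj₁ (m≤p , p≤c))
between-split {p = p} m (inj₂ (c≤p , p≤a)) with ≤-total p m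
... | inj₁ p≤m = inj₂ (inj₂ (c≤p , p≤m))
... | inj₂ m≤p = inj₁ (inj₂ (m≤p , p≤a))

between-same : ∀ {a p} → Between a p a → p ≡ a
between-same (inj₁ (a≤p , p≤a)) = ≤-antisym p≤a a≤p
between-same (inj₂ (a≤p , p≤a)) = ≤-antisym p≤a a≤p

between-suc : ∀ {a p} → Between a p (suc a) → a ≤ p × p ≤ suc a
between-suc (inj₁ a≤p≤1+a) = a≤p≤1+a
between-suc {a} (inj₂ (1+a≤p , p≤a)) = ≤-trans (n≤1+n a) 1+a≤p , m≤n⇒m≤1+n p≤a

-- A discrete intermediate value theorem: some unit step of the argument straddles p.
between-step : ∀ (g : ℕ → ℕ) {u v p} → u ≤ v → Between (g u) p (g v) →
  p ≡ g u ⊎ ∃[ w ] (u ≤ w × w < v × Between (g w) p (g (suc w)))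
between-step g u≤v btw with m≤n⇒m<n∨m≡n u≤v
between-step g u≤v btw | inj₂ refl = inj₁ (between-same btw)
between-step g {v = suc v} u≤v btw | inj₁ (s≤s u≤v') with between-split (g v) btw
... | inj₂ btw' = inj₂ (v , u≤v' , ≤-refl , btw')
... | inj₁ btw' with between-step g u≤v' btw'
...   | inj₁ p≡gu = inj₁ p≡gu
...   | inj₂ (w , u≤w , w<v , btw'') = inj₂ (w , u≤w , m≤n⇒m≤1+n w<v , btw'')

range-∈⁺ : ∀ {t w y} → t ≤ w → w ≤ y → w ∈ rangeList t y
range-∈⁺ {t} {w} {y} t≤w w≤y =
  subst (_∈ rangeList t y) (m+[n∸m]≡n t≤w)
    (∈-map⁺ (t +_) (∈-upTo⁺ (∸-monoˡ-< (s≤s w≤y) t≤w)))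

range-∈⁻ : ∀ {t w y} → w ∈ rangeList t y → t ≤ w × w ≤ y
range-∈⁻ {t} {w} {y} w∈ with ∈-map⁻ (t +_) w∈
... | k , k∈ , refl =
  m≤m+n t k , subst (_≤ y) (+-comm k t) (s≤s⁻¹ (m≤o∸n⇒m+n≤o (suc k) (<⇒≤ t<1+y) k<))
  where
  k< : k < suc y ∸ t
  k< = ∈-upTo⁻ k∈
  t<1+y : t < suc y
  t<1+y = m∸n≢0⇒n<m (λ eq → n≮0 (subst (k <_) eq k<))

range-All : ∀ {P : ℕ → Set} (f : ℕ → ℕ) {t y} → (∀ w → t ≤ w → w ≤ y → P (f w)) →
  All P (map f (rangeList t y))
range-All f h = All.map⁺ (All.tabulate (λ w∈ → let t≤w , w≤y = range-∈⁻ w∈ in h _ t≤w w≤y))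

minOver-≤ : ∀ f {t w y} → t ≤ w → w ≤ y → minOver f t y ≤ f w
minOver-≤ f t≤w w≤y =
  foldr-preservesᵒ (λ a c → [ ≤-trans (m⊓n≤m a c) , ≤-trans (m⊓n≤n a c) ]′) _ _
    (inj₂ (Any.map (≤-reflexive ∘ sym) (∈-map⁺ f (range-∈⁺ t≤w w≤y))))

minOver-attained : ∀ f {t y} → t ≤ y → ∃[ w ] (t ≤ w × w ≤ y × minOver f t y ≡ f w)
minOver-attained f {t} t≤y with foldr-selective {_•_ = _⊓_} ⊓-sel (f t) (map f (rangeList t _))
... | inj₁ eq = t , ≤-refl , t≤y , eq
... | inj₂ m∈ with ∈-map⁻ f m∈
...   | w , w∈ , eq = let t≤w , w≤y = range-∈⁻ w∈ in w , t≤w , w≤y , eq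

maxOver-≥ : ∀ f {t w y} → t ≤ w → w ≤ y → f w ≤ maxOver f t y
maxOver-≥ f t≤w w≤y =
  foldr-preservesᵒ
    (λ a c → [ (λ le → ≤-trans le (m≤m⊔n a c)) , (λ le → ≤-trans le (m≤n⊔m a c)) ]′) _ _
    (inj₂ (Any.map ≤-reflexive (∈-map⁺ f (range-∈⁺ t≤w w≤y))))

maxOver-least : ∀ f {m t y} → t ≤ y → (∀ w → t ≤ w → w ≤ y → f w ≤ m) → maxOver f t y ≤ m
maxOver-least f {m} t≤y h = foldr-preservesᵇ {P = _≤ m} ⊔-lub (h _ ≤-refl t≤y) (range-All f h)

maxOver-attained : ∀ f {t y} → t ≤ y → ∃[ w ] (t ≤ w × w ≤ y × maxOver f t y ≡ f w)
maxOver-attained f {t} t≤y with foldr-selective {_•_ = _⊔_} ⊔-sel (f t) (map f (rangeList t _))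
... | inj₁ eq = t , ≤-refl , t≤y , eq
... | inj₂ m∈ with ∈-map⁻ f m∈
...   | w , w∈ , eq = let t≤w , w≤y = range-∈⁻ w∈ in w , t≤w , w≤y , eq

IsMinOn : (ℕ → ℕ) → ℕ → ℕ → ℕ → Set
IsMinOn f t x a = (∀ w → t ≤ w → w < x → a ≤ f w) × ∃[ w ] (t ≤ w × w < x × f w ≡ a)

isMinOn-unique : ∀ {f t x a a'} → IsMinOn f t x a → IsMinOn f t x a' → a ≡ a'
isMinOn-unique (a≤ , w , t≤w , w<x , refl) (a'≤ , w' , t≤w' , w'<x , refl) =
  ≤-antisym (a≤ w' t≤w' w'<x) (a'≤ w t≤w w<x)

isMinOn-single : ∀ {f t} → IsMinOn f t (suc t) (f t)
isMinOn-single {f} {t} = lower , t , ≤-refl , ≤-refl , refl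
  where
  lower : ∀ w → t ≤ w → w < suc t → f t ≤ f w
  lower w t≤w (s≤s w≤t) with ≤-antisym t≤w w≤t
  ... | refl = ≤-refl

isMinOn-extend : ∀ {f t x a} → t < x → IsMinOn f (suc t) x a → IsMinOn f t x (a ⊓ f t)
isMinOn-extend {f} {t} {x} {a} t<x (a≤ , w , t<w , w<x , fw≡a) = lower , witness (⊓-sel a (f t))
  where
  lower : ∀ w → t ≤ w → w < x → a ⊓ f t ≤ f w
  lower w t≤w w<x with m≤n⇒m<n∨m≡n t≤w
  ... | inj₁ t<w = ≤-trans (m⊓n≤m a (f t)) (a≤ w t<w w<x)
  ... | inj₂ refl = m⊓n≤n a (f t)
  witness : a ⊓ f t ≡ a ⊎ a ⊓ f t ≡ f t → ∃[ w ] (t ≤ w × w < x × f w ≡ a ⊓ f t)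
  witness (inj₁ eq) = w , <⇒≤ t<w , w<x , trans fw≡a (sym eq)
  witness (inj₂ eq) = t , ≤-refl , t<x , sym eq

isMinOn-minOver : ∀ f {t y} → t ≤ y → IsMinOn f t (suc y) (minOver f t y)
isMinOn-minOver f t≤y =
  (λ w t≤w w≤y → minOver-≤ f t≤w (s≤s⁻¹ w≤y)) ,
  (let w , t≤w , w≤y , eq = minOver-attained f t≤y in w , t≤w , s≤s w≤y , sym eq)

isMinOn⇔minOver : ∀ f {t x a} → t < x → IsMinOn f t x a ⇔ a ≡ minOver f t (x ∸ 1)
isMinOn⇔minOver f {x = suc y} (s≤s t≤y) =
  mk⇔ (λ min → isMinOn-unique min (isMinOn-minOver f t≤y)) (λ { refl → isMinOn-minOver f t≤y })

DelimitedWithin : ∀ {n} → SignedPerm n → ℕ → ℕ → Set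
DelimitedWithin P t x = ∀ w → t ≤ w → w < x → ∀ e → InDelim P w e → Range t x e

module Positions {n} {{_ : NonZero n}} (P : SignedPerm n) where

  -- The position of the element v ∈ [n]; meaningless outside [n].
  positionOf : ℕ → Fin n
  positionOf v = perm P ⟨$⟩ˡ ((v ∸ 1) mod n)

  place : ℕ → ℕ
  place = toℕ ∘ positionOf

  elemAt-positionOf : ∀ {v} → 1 ≤ v → v ≤ n → elemAt P (positionOf v) ≡ v
  elemAt-positionOf {suc v} _ v<n =
    cong suc (trans (cong toℕ (inverseʳ (perm P))) (trans (toℕ-fromℕ< _) (m<n⇒m%n≡m v<n)))

  inDelim-self : ∀ {t} → 1 ≤ t → t < n → InDelim P t t
  inDelim-self {t} 1≤t t<n =
    positionOf t , positionOf (suc t) , positionOf t ,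
    elemAt-t , elemAt-positionOf (s≤s z≤n) t<n , left-end , elemAt-t
    where
    elemAt-t : elemAt P (positionOf t) ≡ t
    elemAt-t = elemAt-positionOf 1≤t (<⇒≤ t<n)
    left-end : Between (place t) (place t) (place (suc t))
    left-end with ≤-total (place t) (place (suc t))
    ... | inj₁ le = inj₁ (≤-refl , le)
    ... | inj₂ ge = inj₂ (ge , ≤-refl)

  -- A position between the leftmost and the rightmost position of t..x lies between the positions
  -- of some w and w+1 with t ≤ w < x (between-step), hence holds an element of t..x.
  range-isInterval : ∀ {t x} → 1 ≤ t → t < x → x ≤ n → DelimitedWithin P t x →
    IsIntervalOf P (Range t x)
  range-isInterval {t} {x} 1≤t t<x x≤n closed
    with minOver-attained place (<⇒≤ t<x) | maxOver-attained place (<⇒≤ t<x)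
  ... | v₁ , t≤v₁ , v₁≤x , first≡ | v₂ , t≤v₂ , v₂≤x , last≡ =
    positionOf v₁ , positionOf v₂ , first<last , λ e → mk⇔ (inside e) (outside e)
    where
    t≤x : t ≤ x
    t≤x = <⇒≤ t<x

    elemAt-position : ∀ {v} → t ≤ v → v ≤ x → elemAt P (positionOf v) ≡ v
    elemAt-position t≤v v≤x = elemAt-positionOf (≤-trans 1≤t t≤v) (≤-trans v≤x x≤n)

    first≤ : ∀ {w} → t ≤ w → w ≤ x → place v₁ ≤ place w
    first≤ {w} t≤w w≤x = subst (_≤ place w) first≡ (minOver-≤ place t≤w w≤x)

    ≤last : ∀ {w} → t ≤ w → w ≤ x → place w ≤ place v₂
    ≤last {w} t≤w w≤x = subst (place w ≤_) last≡ (maxOver-≥ place t≤w w≤x)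

    place-t≢ : place t ≢ place (suc t)
    place-t≢ eq = 1+n≢n (sym (begin
      t                              ≡⟨ elemAt-position ≤-refl t≤x ⟨
      elemAt P (positionOf t)        ≡⟨ cong (elemAt P) (toℕ-injective eq) ⟩
      elemAt P (positionOf (suc t))  ≡⟨ elemAt-position (n≤1+n t) t<x ⟩
      suc t                          ∎))
      where open ≡-Reasoning

    first<last : place v₁ < place v₂
    first<last with ≤-total (place t) (place (suc t))
    ... | inj₁ le =
      <-≤-trans (≤-<-trans (first≤ ≤-refl t≤x) (≤∧≢⇒< le place-t≢)) (≤last (n≤1+n t) t<x)
    ... | inj₂ ge =
      <-≤-trans (≤-<-trans (first≤ (n≤1+n t) t<x) (≤∧≢⇒< ge (place-t≢ ∘ sym))) (≤last ≤-refl t≤x)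

    Window : ℕ → Set
    Window e = ∃[ p ] (positionOf v₁ Fin.≤ p × p Fin.≤ positionOf v₂ × elemAt P p ≡ e)

    inside : ∀ e → Range t x e → Window e
    inside e (t≤e , e≤x) = positionOf e , first≤ t≤e e≤x , ≤last t≤e e≤x , elemAt-position t≤e e≤x

    straddled : ∀ {u v} (p : Fin n) → t ≤ u → u ≤ x → u ≤ v → v ≤ x →
      Between (place u) (toℕ p) (place v) → Range t x (elemAt P p)
    straddled p t≤u u≤x u≤v v≤x btw with between-step place u≤v btw
    ... | inj₁ p≡ =
      subst (Range t x) (sym (trans (cong (elemAt P) (toℕ-injective p≡)) (elemAt-position t≤u u≤x))) (t≤u , u≤x)
    ... | inj₂ (w , u≤w , w<v , btw') =
      closed w t≤w w<x (elemAt P p)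
        (positionOf w , positionOf (suc w) , p ,
         elemAt-position t≤w (<⇒≤ w<x) , elemAt-position (m≤n⇒m≤1+n t≤w) w<x , btw' , refl)
      where
      t≤w : t ≤ w
      t≤w = ≤-trans t≤u u≤w
      w<x : w < x
      w<x = <-≤-trans w<v v≤x

    outside : ∀ e → Window e → Range t x e
    outside e (p , first≤p , p≤last , refl) with ≤-total v₁ v₂
    ... | inj₁ le = straddled p t≤v₁ v₁≤x le v₂≤x (inj₁ (first≤p , p≤last))
    ... | inj₂ ge = straddled p t≤v₂ v₂≤x ge v₁≤x (inj₂ (first≤p , p≤last))

elemAt-identity : ∀ {n} (P : SignedPerm n) → IsId P → ∀ q → elemAt P q ≡ suc (toℕ q)
elemAt-identity P isId q = cong (suc ∘ toℕ) (isId q)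

inDelim-identity : ∀ {n} (P : SignedPerm n) → IsId P → ∀ {w e} → InDelim P w e → w ≤ e × e ≤ suc w
inDelim-identity P isId (i , j , p , eᵢ , eⱼ , btw , eₚ)
  with refl ← trans (sym (elemAt-identity P isId i)) eᵢ
     | refl ← trans (sym (elemAt-identity P isId p)) eₚ =
  let j≡1+i = suc-injective (trans (sym (elemAt-identity P isId j)) eⱼ)
      i≤p , p≤1+i = between-suc (subst (Between (toℕ i) (toℕ p)) j≡1+i btw)
  in s≤s i≤p , s≤s p≤1+i

isCommonInterval-resp : ∀ {n K} (Ps : Fin K → SignedPerm n) {I J} →
  SetEq I J → IsCommonInterval Ps J → IsCommonInterval Ps I
isCommonInterval-resp Ps I≈J common k =
  let i , j , i<j , J≈ = common k in i , j , i<j , λ e → Compose.equivalence (I≈J e) (J≈ e)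

belowMin-≤ : ∀ {n K} {{_ : NonZero n}} (Ps : Fin (suc (suc K)) → SignedPerm n) {t v} →
  1 ≤ t → t < n → BelowMin Ps t v → v ≤ t
belowMin-≤ Ps 1≤t t<n below = below (Fin.suc Fin.zero) (λ ()) _ (Positions.inDelim-self (Ps _) 1≤t t<n)

range-isCommonInterval : ∀ {n K} {{_ : NonZero n}} (Ps : Fin K → SignedPerm n) →
  (∀ k → toℕ k ≡ 0 → IsId (Ps k)) →
  ∀ (b B : ℕ → ℕ) {t x} → 1 ≤ t → t < x → x ≤ n →
  (∀ w → t ≤ w → w < x → BelowMin Ps w (b w) × AboveMax Ps w (B w)) →
  (∀ w → t ≤ w → w < x → t ≤ b w × B w ≤ x) →
  IsCommonInterval Ps (Range t x)
range-isCommonInterval Ps isId b B {t} {x} 1≤t t<x x≤n bounds range k =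
  Positions.range-isInterval (Ps k) 1≤t t<x x≤n delimited
  where
  delimited : DelimitedWithin (Ps k) t x
  delimited w t≤w w<x e inDelim with toℕ k ≟ 0
  ... | yes k≡0 = let w≤e , e≤1+w = inDelim-identity (Ps k) (isId k k≡0) inDelim in
    ≤-trans t≤w w≤e , ≤-trans e≤1+w w<x
  ... | no k≢0 =
    let below , above = bounds w t≤w w<x
        t≤bw , Bw≤x = range w t≤w w<x
    in ≤-trans t≤bw (below k k≢0 e inDelim) , ≤-trans (above k k≢0 e inDelim) Bw≤x

Pair : Set
Pair = ℕ × List ℕ

Sorted : State → Set
Sorted = AllPairs (λ q r → proj₁ r < proj₁ q)

KeysAtMost : ℕ → State → Set
KeysAtMost c = All (λ q → proj₁ q ≤ c)

Stores : State → ℕ → ℕ → Set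
Stores s a x = ∃[ S ] ((a , S) ∈ s × x ∈ S)

≡ᵇ-true : ∀ {m n} → (m ≡ᵇ n) ≡ true → m ≡ n
≡ᵇ-true {m} {n} eq = ≡ᵇ⇒≡ m n (subst T (sym eq) tt)

≡ᵇ-false : ∀ {m n} → (m ≡ᵇ n) ≡ false → m ≢ n
≡ᵇ-false eq m≡n = subst T eq (≡⇒≡ᵇ _ _ m≡n)

<ᵇ-true : ∀ {m n} → (m <ᵇ n) ≡ true → m < n
<ᵇ-true {m} {n} eq = <ᵇ⇒< m n (subst T (sym eq) tt)

<ᵇ-false : ∀ {m n} → (m <ᵇ n) ≡ false → ¬ m < n
<ᵇ-false eq m<n = subst T eq (<⇒<ᵇ m<n)

stores-++ˡ : ∀ {s r a x} → Stores s a x → Stores (s ++ r) a x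
stores-++ˡ (S , q∈ , x∈) = S , ∈-++⁺ˡ q∈ , x∈

stores-++ʳ : ∀ s {r a x} → Stores r a x → Stores (s ++ r) a x
stores-++ʳ s (S , q∈ , x∈) = S , ∈-++⁺ʳ s q∈ , x∈

stores-++⁻ : ∀ s {r a x} → Stores (s ++ r) a x → Stores s a x ⊎ Stores r a x
stores-++⁻ s (S , q∈ , x∈) with ∈-++⁻ s q∈
... | inj₁ q∈s = inj₁ (S , q∈s , x∈)
... | inj₂ q∈r = inj₂ (S , q∈r , x∈)

⋃ : State → List ℕ
⋃ s = concat (map proj₂ s)

⋃-stores⁻ : ∀ {s x} → x ∈ ⋃ s → ∃[ a ] Stores s a x
⋃-stores⁻ {s} x∈ with ∈-concat⁻′ (map proj₂ s) x∈
... | S , x∈S , S∈ with ∈-map⁻ proj₂ S∈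
...   | (a , S) , q∈ , refl = a , S , q∈ , x∈S

⋃-stores⁺ : ∀ {s a x} → Stores s a x → x ∈ ⋃ s
⋃-stores⁺ (S , q∈ , x∈) = ∈-concat⁺′ x∈ (∈-map⁺ proj₂ q∈)

keysAtMost-sorted : ∀ {c q s} → Sorted (q ∷ s) → proj₁ q ≤ c → KeysAtMost c (q ∷ s)
keysAtMost-sorted (q>s ∷ _) q≤c = q≤c ∷ All.map (λ r<q → <⇒≤ (<-≤-trans r<q q≤c)) q>s

stores-key : ∀ {P : ℕ → Set} {s a x} → All (P ∘ proj₁) s → Stores s a x → P a
stores-key all (_ , q∈ , _) = All.lookup all q∈

span-keys : ∀ c s → Sorted s → let pre , rest = span (λ (q : Pair) → c <? proj₁ q) s in
  pre ++ rest ≡ s × All (λ q → c < proj₁ q) pre × KeysAtMost c rest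
span-keys c [] [] = refl , [] , []
span-keys c (q ∷ s) sorted@(_ ∷ sorted') with c <ᵇ proj₁ q in test
... | true = let eq , pre> , rest≤ = span-keys c s sorted' in cong (q ∷_) eq , <ᵇ-true test ∷ pre> , rest≤
... | false = refl , [] , keysAtMost-sorted sorted (≮⇒≥ (<ᵇ-false test))

⊓-keysAtMost : ∀ {c s a x} → KeysAtMost c s → Stores s a x → a ≡ a ⊓ c
⊓-keysAtMost ≤c st = sym (m≤n⇒m⊓n≡m (stores-key ≤c st))

⊓-keysAbove : ∀ {c s x} → All (λ q → c < proj₁ q) s → x ∈ ⋃ s → ∃[ a ] (Stores s a x × c ≡ a ⊓ c)
⊓-keysAbove >c x∈ with ⋃-stores⁻ x∈
... | a , st = a , st , sym (m≥n⇒m⊓n≡n (<⇒≤ (stores-key >c st)))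

sorted-++⁻ʳ : ∀ s {r} → Sorted (s ++ r) → Sorted r
sorted-++⁻ʳ [] sorted = sorted
sorted-++⁻ʳ (_ ∷ s) (_ ∷ sorted) = sorted-++⁻ʳ s sorted

module StepLemmas (n : ℕ) (b B : ℕ → ℕ) (t : ℕ) where
  open LR n b B

  Split : State → State × State
  Split s = span (λ (q : Pair) → b t <? proj₁ q) s

  stepI-view⁻ : ∀ s {a x} → Stores (stepI t s) a x →
    (a ≡ b t × x ∈ ⋃ (proj₁ (Split s))) ⊎ Stores (proj₂ (Split s)) a x
  stepI-view⁻ s st with Split s
  ... | [] , rest = inj₂ st
  ... | _ ∷ _ , [] with st
  ...   | _ , here refl , x∈ = inj₁ (refl , x∈)
  stepI-view⁻ s st | pre@(_ ∷ _) , (a' , S') ∷ rest with a' ≡ᵇ b t in test | st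
  ... | true | _ , here refl , x∈ with ∈-++⁻ (⋃ pre) x∈
  ...   | inj₁ x∈pre = inj₁ (refl , x∈pre)
  ...   | inj₂ x∈S' = inj₂ (S' , here (cong (_, S') (sym (≡ᵇ-true test))) , x∈S')
  stepI-view⁻ s st | pre@(_ ∷ _) , (a' , S') ∷ rest | true | S , there q∈ , x∈ = inj₂ (S , there q∈ , x∈)
  stepI-view⁻ s st | pre@(_ ∷ _) , (a' , S') ∷ rest | false | _ , here refl , x∈ = inj₁ (refl , x∈)
  stepI-view⁻ s st | pre@(_ ∷ _) , (a' , S') ∷ rest | false | S , there q∈ , x∈ = inj₂ (S , q∈ , x∈)

  stepI-view⁺ : ∀ s {a x} →
    (x ∈ ⋃ (proj₁ (Split s)) → Stores (stepI t s) (b t) x) ×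
    (Stores (proj₂ (Split s)) a x → Stores (stepI t s) a x)
  stepI-view⁺ s with Split s
  ... | [] , rest = (λ ()) , λ st → st
  ... | _ ∷ _ , [] = (λ x∈ → _ , here refl , x∈) , λ ()
  ... | pre@(_ ∷ _) , (a' , S') ∷ rest with a' ≡ᵇ b t in test
  ...   | true = (λ x∈ → _ , here refl , ∈-++⁺ˡ x∈) , λ where
    (_ , here refl , x∈) → _ , here (cong (_, _) (≡ᵇ-true test)) , ∈-++⁺ʳ (⋃ pre) x∈
    (S , there q∈ , x∈) → S , there q∈ , x∈
  ...   | false = (λ x∈ → _ , here refl , x∈) , λ (S , q∈ , x∈) → S , there q∈ , x∈

  stepI-sorted : ∀ s → Sorted s → Sorted (stepI t s) × KeysAtMost (b t) (stepI t s)
  stepI-sorted s sorted with Split s | span-keys (b t) s sorted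
  ... | [] , rest | refl , _ , rest≤ = sorted , rest≤
  ... | _ ∷ _ , [] | _ = [] ∷ [] , ≤-refl ∷ []
  ... | pre@(_ ∷ _) , (a' , S') ∷ rest | refl , _ , a'≤ ∷ rest≤ with a' ≡ᵇ b t in test | sorted-++⁻ʳ pre sorted
  ...   | true | rest<a' ∷ sorted' =
    subst (λ c → All (λ q → proj₁ q < c) rest) (≡ᵇ-true test) rest<a' ∷ sorted' , ≤-refl ∷ rest≤
  ...   | false | sorted'@(rest<a' ∷ _) =
    (a'<bt ∷ All.map (λ r<a' → <-trans r<a' a'<bt) rest<a') ∷ sorted' , ≤-refl ∷ a'≤ ∷ rest≤
    where
    a'<bt : a' < b t
    a'<bt = ≤∧≢⇒< a'≤ (≡ᵇ-false test)

  stepI-stores⁻ : ∀ s {a x} → Sorted s → Stores (stepI t s) a x →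
    ∃[ a' ] (Stores s a' x × a ≡ a' ⊓ b t)
  stepI-stores⁻ s sorted st with Split s | span-keys (b t) s sorted | stepI-view⁻ s st
  ... | pre , rest | refl , pre> , _ | inj₁ (refl , x∈) =
    let a' , st' , eq = ⊓-keysAbove pre> x∈ in a' , stores-++ˡ st' , eq
  ... | pre , rest | refl , _ , rest≤ | inj₂ st' = _ , stores-++ʳ pre st' , ⊓-keysAtMost rest≤ st'

  stepI-stores⁺ : ∀ s {a x} → Sorted s → Stores s a x → ∃[ a' ] Stores (stepI t s) a' x
  stepI-stores⁺ s sorted st with Split s | span-keys (b t) s sorted | stepI-view⁺ s
  ... | pre , rest | refl , _ | pre⁺ , rest⁺ with stores-++⁻ pre st
  ...   | inj₁ st' = _ , pre⁺ (⋃-stores⁺ st')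
  ...   | inj₂ st' = _ , rest⁺ st'

  private
    keepAbove : Pair → Pair
    keepAbove q = proj₁ q , List.filterᵇ (λ x → B t ≤ᵇ x) (proj₂ q)

  stepII-stores⁻ : ∀ s {a x} → Stores (stepII t s) a x → Stores s a x × B t ≤ x
  stepII-stores⁻ s (S , q∈ , x∈) with ∈-filter⁻ _ q∈
  ... | q∈' , _ with ∈-map⁻ keepAbove q∈'
  ...   | (a , S') , q∈s , refl with ∈-filter⁻ _ {xs = S'} x∈
  ...     | x∈S' , Bt≤x = (S' , q∈s , x∈S') , ≤ᵇ⇒≤ (B t) _ Bt≤x

  stepII-stores⁺ : ∀ s {a x} → Stores s a x → B t ≤ x → Stores (stepII t s) a x
  stepII-stores⁺ s {x = x} (S , q∈ , x∈) Bt≤x =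
    _ , ∈-filter⁺ _ (∈-map⁺ keepAbove q∈) (nonEmpty-∈ x∈') , x∈'
    where
    x∈' : x ∈ List.filterᵇ (B t ≤ᵇ_) S
    x∈' = ∈-filter⁺ (T? ∘ (B t ≤ᵇ_)) x∈ (≤⇒≤ᵇ Bt≤x)
    nonEmpty-∈ : ∀ {x S} → x ∈ S → T (nonEmpty S)
    nonEmpty-∈ (here _) = tt
    nonEmpty-∈ (there _) = tt

  stepII-sorted : ∀ {c} s → Sorted s → KeysAtMost c s → Sorted (stepII t s) × KeysAtMost c (stepII t s)
  stepII-sorted s sorted keys =
    AllPairs.filter⁺ _ (AllPairs.map⁺ sorted) , All.filter⁺ _ (All.map⁺ keys)

  stepIII-stores⁻ : ∀ s {a x} → Stores (stepIII t s) a x →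
    Stores s a x ⊎ (B t ≡ suc t × a ≡ b t × x ≡ suc t)
  stepIII-stores⁻ s st with B t ≡ᵇ suc t in fires | s
  ... | false | _ = inj₁ st
  ... | true | [] with st
  ...   | _ , here refl , here refl = inj₂ (≡ᵇ-true fires , refl , refl)
  stepIII-stores⁻ s st | true | (a₁ , S₁) ∷ rest with a₁ ≡ᵇ b t in same | st
  ... | true | _ , here refl , x∈ with ∈-++⁻ S₁ x∈
  ...   | inj₁ x∈S₁ = inj₁ (S₁ , here refl , x∈S₁)
  ...   | inj₂ (here refl) = inj₂ (≡ᵇ-true fires , ≡ᵇ-true same , refl)
  stepIII-stores⁻ s st | true | (a₁ , S₁) ∷ rest | true | S , there q∈ , x∈ = inj₁ (S , there q∈ , x∈)
  stepIII-stores⁻ s st | true | (a₁ , S₁) ∷ rest | false | _ , here refl , here refl = inj₂ (≡ᵇ-true fires , refl , refl)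
  stepIII-stores⁻ s st | true | (a₁ , S₁) ∷ rest | false | S , there q∈ , x∈ = inj₁ (S , q∈ , x∈)

  stepIII-stores⁺ : ∀ s {a x} → Stores s a x → Stores (stepIII t s) a x
  stepIII-stores⁺ s st with B t ≡ᵇ suc t | s
  ... | false | _ = st
  ... | true | (a₁ , S₁) ∷ rest with a₁ ≡ᵇ b t | st
  ...   | true | _ , here refl , x∈ = _ , here refl , ∈-++⁺ˡ x∈
  ...   | true | S , there q∈ , x∈ = S , there q∈ , x∈
  ...   | false | S , q∈ , x∈ = S , there q∈ , x∈

  stepIII-new : ∀ s → B t ≡ suc t → Stores (stepIII t s) (b t) (suc t)
  stepIII-new s fires with B t ≡ᵇ suc t in test | s
  ... | false | _ = contradiction fires (≡ᵇ-false test)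
  ... | true | [] = _ , here refl , here refl
  ... | true | (a₁ , S₁) ∷ rest with a₁ ≡ᵇ b t in same
  ...   | true = _ , here (cong (_, _) (sym (≡ᵇ-true same))) , ∈-++⁺ʳ S₁ (here refl)
  ...   | false = _ , here refl , here refl

  stepIII-sorted : ∀ s → Sorted s → KeysAtMost (b t) s → Sorted (stepIII t s)
  stepIII-sorted s sorted keys with B t ≡ᵇ suc t | s
  ... | false | _ = sorted
  ... | true | [] = [] ∷ []
  ... | true | (a₁ , S₁) ∷ rest with a₁ ≡ᵇ b t in same | sorted | keys
  ...   | true | rest<a₁ ∷ sorted' | _ = rest<a₁ ∷ sorted'
  ...   | false | sorted'@(rest<a₁ ∷ _) | a₁≤ ∷ _ =
    (a₁<bt ∷ All.map (λ r<a₁ → <-trans r<a₁ a₁<bt) rest<a₁) ∷ sorted'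
    where
    a₁<bt : a₁ < b t
    a₁<bt = ≤∧≢⇒< a₁≤ (≡ᵇ-false same)

module Correctness (n : ℕ) (b B : ℕ → ℕ) where
  open LR n b B
  open StepLemmas n b B

  Candidate : ℕ → ℕ → Set
  Candidate t x = t < x × x ≤ n × B (x ∸ 1) ≡ x × (∀ w → t ≤ w → w < x → B w ≤ x)

  candidate-extend : ∀ {t x} → Candidate (suc t) x → B t ≤ x → Candidate t x
  candidate-extend {t} {x} (t<x , x≤n , Bx , B≤) Bt≤x = <⇒≤ t<x , x≤n , Bx , B≤′
    where
    B≤′ : ∀ w → t ≤ w → w < x → B w ≤ x
    B≤′ w t≤w w<x with m≤n⇒m<n∨m≡n t≤w
    ... | inj₁ t<w = B≤ w t<w w<x
    ... | inj₂ refl = Bt≤x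

  candidate-shrink : ∀ {t x} → Candidate t x → suc t < x → Candidate (suc t) x
  candidate-shrink (_ , x≤n , Bx , B≤) 1+t<x = 1+t<x , x≤n , Bx , λ w t<w → B≤ w (<⇒≤ t<w)

  candidate-single : ∀ {t} → t < n → B t ≡ suc t → Candidate t (suc t)
  candidate-single {t} t<n Bt = ≤-refl , t<n , Bt , B≤
    where
    B≤ : ∀ w → t ≤ w → w < suc t → B w ≤ suc t
    B≤ w t≤w (s≤s w≤t) with ≤-antisym t≤w w≤t
    ... | refl = ≤-reflexive Bt

  candidate⇔ : ∀ {t x} → Candidate t x ⇔ (t < x × x ≤ n × x ≡ B (x ∸ 1) × x ≡ maxOver B t (x ∸ 1))
  candidate⇔ {t} = mk⇔ to from
    where
    to : ∀ {x} → Candidate t x → t < x × x ≤ n × x ≡ B (x ∸ 1) × x ≡ maxOver B t (x ∸ 1)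
    to {suc y} (t<x@(s≤s t≤y) , x≤n , Bx , B≤) =
      t<x , x≤n , sym Bx ,
      ≤-antisym (subst (_≤ maxOver B t y) Bx (maxOver-≥ B t≤y ≤-refl))
                (maxOver-least B t≤y (λ w t≤w w≤y → B≤ w t≤w (s≤s w≤y)))
    from : ∀ {x} → t < x × x ≤ n × x ≡ B (x ∸ 1) × x ≡ maxOver B t (x ∸ 1) → Candidate t x
    from {suc y} (t<x , x≤n , x≡B , x≡max) =
      t<x , x≤n , sym x≡B , λ w t≤w w<x → subst (B w ≤_) (sym x≡max) (maxOver-≥ B t≤w (s≤s⁻¹ w<x))

  record Invariant (t : ℕ) (s : State) : Set where
    field
      sorted : Sorted s
      sound : ∀ {a x} → Stores s a x → Candidate t x × IsMinOn b t x a
      complete : ∀ {x} → Candidate t x → ∃[ a ] Stores s a x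

  invariant-start : Invariant n []
  invariant-start = record
    { sorted = []
    ; sound = λ ()
    ; complete = λ (t<x , x≤n , _) → contradiction (<-≤-trans t<x x≤n) (<-irrefl refl) }

  invariant-step : ∀ {t s} → t < n → Invariant (suc t) s → Invariant t (step t s)
  invariant-step {t} {s} t<n inv = record { sorted = sorted′ ; sound = sound′ ; complete = complete′ }
    where
    open Invariant inv
    sorted′ : Sorted (step t s)
    sorted′ =
      let sortedI , keysI = stepI-sorted t s sorted
          sortedII , keysII = stepII-sorted t _ sortedI keysI
      in stepIII-sorted t _ sortedII keysII

    sound′ : ∀ {a x} → Stores (step t s) a x → Candidate t x × IsMinOn b t x a
    sound′ st with stepIII-stores⁻ t _ st
    ... | inj₂ (Bt , refl , refl) = candidate-single t<n Bt , isMinOn-single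
    ... | inj₁ stII with stepII-stores⁻ t _ stII
    ...   | stI , Bt≤x with stepI-stores⁻ t s sorted stI
    ...     | a' , st₀ , refl =
      let cand , min = sound st₀ in candidate-extend cand Bt≤x , isMinOn-extend (<⇒≤ (proj₁ cand)) min

    complete′ : ∀ {x} → Candidate t x → ∃[ a ] Stores (step t s) a x
    complete′ cand@(t<x , _ , Bx , B≤) with m≤n⇒m<n∨m≡n t<x
    ... | inj₂ refl = _ , stepIII-new t _ Bx
    ... | inj₁ 1+t<x =
      let a , st₀ = complete (candidate-shrink cand 1+t<x)
          a' , stI = stepI-stores⁺ t s sorted st₀
      in a' , stepIII-stores⁺ t _ (stepII-stores⁺ t _ stI (B≤ t ≤-refl t<x))

  invariant-run : ∀ k → k ≤ n → Invariant (n ∸ k) (run k)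
  invariant-run zero _ = invariant-start
  invariant-run (suc k) k<n =
    invariant-step (subst (_≤ n) n∸k≡ (m∸n≤m n k))
      (subst (λ t → Invariant t (run k)) n∸k≡ (invariant-run k (<⇒≤ k<n)))
    where
    n∸k≡ : n ∸ k ≡ suc (n ∸ suc k)
    n∸k≡ = +-∸-assoc 1 k<n

  invariant-after : ∀ {t} → t ≤ n → Invariant t (run (n ∸ t))
  invariant-after {t} t≤n =
    subst (λ u → Invariant u (run (n ∸ t))) (m∸[m∸n]≡n t≤n) (invariant-run (n ∸ t) (m∸n≤m n t))

  lookupSet-stores : ∀ {t x} s → x ∈ lookupSet t s → Stores s t x
  lookupSet-stores {t} ((a , S) ∷ rest) x∈ with a ≡ᵇ t in same
  ... | true = S , here (cong (_, S) (sym (≡ᵇ-true same))) , x∈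
  ... | false = let S' , q∈ , x∈S' = lookupSet-stores rest x∈ in S' , there q∈ , x∈S'

  stores-lookupSet : ∀ {t x} s → Sorted s → Stores s t x → x ∈ lookupSet t s
  stores-lookupSet {t} ((a , S) ∷ rest) (rest<a ∷ sorted) st with a ≡ᵇ t in same | st
  ... | true | _ , here refl , x∈ = x∈
  ... | true | S' , there q∈ , x∈ =
    contradiction (≡ᵇ-true same) (<⇒≢ (stores-key rest<a (S' , q∈ , x∈)) ∘ sym)
  ... | false | _ , here refl , _ = contradiction refl (≡ᵇ-false {t} same)
  ... | false | S' , there q∈ , x∈ = stores-lookupSet rest sorted (S' , q∈ , x∈)

  SetT-spec : ∀ {t x} → t ≤ n → x ∈ SetT t ⇔ (Candidate t x × IsMinOn b t x t)
  SetT-spec {t} t≤n = mk⇔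
    (λ x∈ → sound (lookupSet-stores _ x∈))
    (λ (cand , min) → let a , st = complete cand in
      stores-lookupSet _ sorted (subst (λ a → Stores _ a _) (isMinOn-unique (proj₂ (sound st)) min) st))
    where open Invariant (invariant-after t≤n)

theorem1 : (n K : ℕ) → 2 ≤ n → 2 ≤ K →
    (Ps : Fin K → SignedPerm n) → (∀ k → toℕ k ≡ 0 → IsId (Ps k)) →
    (b B : ℕ → ℕ) →
    (∀ t → 1 ≤ t → t ≤ n → 1 ≤ b t × b t ≤ n × 1 ≤ B t × B t ≤ n) →
    (∀ t → 1 ≤ t → t < n → BelowMin Ps t (b t) × AboveMax Ps t (B t)) →
    (I : ℕ → Set) →
    (LR.InUnionPairs n b B I ⇔
      (∃[ t ] ∃[ x ] (1 ≤ t × t < x × x ≤ n × SetEq I (Range t x) ×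
         IsCommonInterval Ps I ×
         t ≡ b t × t ≡ minOver b t (x ∸ 1) ×
         x ≡ B (x ∸ 1) × x ≡ maxOver B t (x ∸ 1))))
theorem1 n@(suc _) (suc (suc _)) (s≤s _) (s≤s (s≤s _)) Ps isId b B _ bounds I = mk⇔
  (λ (t , x , 1≤t , t<n , x∈ , I≈) →
    let cand , min = to (SetT-spec (<⇒≤ t<n)) x∈
        t<x , x≤n , x≡B , x≡max = to candidate⇔ cand
        _ , _ , _ , B≤x = cand
        t≤b , _ = min
        common = range-isCommonInterval Ps isId b B 1≤t t<x x≤n
          (λ w t≤w w<x → bounds w (≤-trans 1≤t t≤w) (<-≤-trans w<x x≤n))
          (λ w t≤w w<x → t≤b w t≤w w<x , B≤x w t≤w w<x)
    in t , x , 1≤t , t<x , x≤n , I≈ , isCommonInterval-resp Ps I≈ common ,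
       ≤-antisym (t≤b t ≤-refl t<x) (belowMin-≤ Ps {t} 1≤t t<n (proj₁ (bounds t 1≤t t<n))) ,
       to (isMinOn⇔minOver b t<x) min , x≡B , x≡max)
  (λ (t , x , 1≤t , t<x , x≤n , I≈ , _ , _ , t≡min , x≡B , x≡max) →
    t , x , 1≤t , <-≤-trans t<x x≤n ,
    from (SetT-spec (≤-trans (<⇒≤ t<x) x≤n))
      (from candidate⇔ (t<x , x≤n , x≡B , x≡max) , from (isMinOn⇔minOver b t<x) t≡min) ,
    I≈)
  where
  open Correctness n b B
  open Equivalence
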